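{- Let $w_1<w_2<\cdots<w_s$ be $s$ distinct nonnegative integers. Suppose that $$\sum_{i=1}^{s}2^{w_i}\equiv\sum_{j=1}^{t}2^{x_j}\pmod{2^{w_s+1}},$$ where $x_1,\ldots,x_t$ are integers (not necessarily distinct) with $0\le x_j<w_s+1$ for all $j$. Then there exist nonempty pairwise disjoint subsets $J_1,\ldots,J_s$ of $\{1,2,\ldots,t\}$ such that $2^{w_i}=\sum_{j\in J_i}2^{x_j}$ for $i=1,\ldots,s$. -}

module Defs where

open import Data.Nat using (ℕ; zero; suc; _+_)
open import Data.Bool using (true; false)
open import Data.Fin using (Fin)
open import Data.Vec using ([]; _∷_)
open import Data.Fin.Subset using (Subset)
open import Data.Fin.Base using () renaming (zero to fz; suc to fs)

sumOver : ∀ {t} → Subset t → (Fin t → ℕ) → ℕ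
sumOver [] f = 0
sumOver (true ∷ J) f = f fz + sumOver J (λ j → f (fs j))
sumOver (false ∷ J) f = sumOver J (λ j → f (fs j))

sumAll : ∀ t → (Fin t → ℕ) → ℕ
sumAll zero f = 0
sumAll (suc t) f = f fz + sumAll t (λ j → f (fs j))

open import Data.Nat using (_^_; _%_)
open import Data.Nat.Properties using (m^n≢0)
open import Relation.Binary.PropositionalEquality using (_≡_)

_≡_[mod2^_] : ℕ → ℕ → ℕ → Set
a ≡ b [mod2^ e ] = _%_ a (2 ^ e) ⦃ m^n≢0 2 e ⦄ ≡ _%_ b (2 ^ e) ⦃ m^n≢0 2 e ⦄

-- Peel off the powers of two on the left from the smallest one up.  Reducing
-- the congruence modulo 2^(w₁+1) shows that the terms 2^(x_j) with x_j ≤ w₁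
-- sum to at least 2^w₁, and powers of two that are each at most 2^a and sum to
-- at least 2^a contain a subfamily summing to exactly 2^a (take a term equal to
-- 2^a if there is one, otherwise two disjoint subfamilies summing to 2^(a-1)).
-- Removing that subfamily from both sides leaves a congruence of the same
-- shape for w₂ < ⋯ < w_s.
module Submission where

open import Defs
open import Data.Nat using (ℕ; suc; _+_; _^_) renaming (_<_ to _<ℕ_)
open import Data.Fin using (Fin; fromℕ; _<_)
open import Data.Fin.Subset using (Subset; Nonempty; Empty; _∩_)
open import Data.Product using (Σ; _×_)
open import Relation.Binary.PropositionalEquality using (_≡_; _≢_)

open import Data.Nat using (zero; _*_; _∸_; _≤_; _≤ᵇ_; _≟_; z≤n; s≤s; z<s; NonZero; s≤s⁻¹)
open import Data.Nat.Properties
open import Data.Nat.Divisibility using (_∣_; divides; _∣0; ∣m∣n⇒∣m+n; n∣m*n; ∣-trans)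
open import Data.Nat.DivMod using (_%_; _/_; m≡m%n+[m/n]*n; m<n⇒m%n≡m; m%n≤m; %-remove-+ʳ)
open import Data.Fin using () renaming (zero to fz; suc to fs)
open import Data.Fin.Properties using (≤fromℕ; any?) renaming (_≟_ to _≟ᶠ_; ≤∧≢⇒< to ≤∧≢⇒<ᶠ)
open import Data.Fin.Subset using (_∈_; _∉_; _⊆_; _∪_; _─_; ⊥; ⊤; ⁅_⁆)
open import Data.Fin.Subset.Properties
  using (_∈?_; drop-∷-⊆; ∩-comm; p∩q⊆p; p∩q⊆q; x∈p∩q⁺; x∈p∩q⁻; x∈p∪q⁻; p─q⊆p; x∈⁅y⁆⇒x≡y)
open import Data.Vec using ([]; _∷_; here; there)
open import Data.Vec.Properties using ([]=⇒lookup)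
open import Data.Vec.Functional using () renaming (_∷_ to _◃_)
open import Data.Bool using (true; false; T)
open import Data.Product using (_,_; ∃-syntax)
open import Data.Sum using (inj₁; inj₂)
open import Data.Empty using (⊥-elim)
open import Function using (_∘_)
open import Relation.Nullary using (yes; no; contradiction; _×-dec_)
open import Relation.Binary.PropositionalEquality using (refl; sym; trans; cong; cong₂; subst; module ≡-Reasoning)
open import Algebra.Properties.CommutativeSemigroup +-commutativeSemigroup using (x∙yz≈y∙xz; xy∙z≈xz∙y)

^-monoʳ-∣ : ∀ b {m n} → m ≤ n → b ^ m ∣ b ^ n
^-monoʳ-∣ b {m} {n} m≤n = divides (b ^ (n ∸ m)) (begin
  b ^ n                ≡⟨ cong (b ^_) (m+[n∸m]≡n m≤n) ⟨
  b ^ (m + (n ∸ m))    ≡⟨ ^-distribˡ-+-* b m (n ∸ m) ⟩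
  b ^ m * b ^ (n ∸ m)  ≡⟨ *-comm (b ^ m) _ ⟩
  b ^ (n ∸ m) * b ^ m  ∎)
  where open ≡-Reasoning

2^[1+n]≡2^n+2^n : ∀ n → 2 ^ suc n ≡ 2 ^ n + 2 ^ n
2^[1+n]≡2^n+2^n n = cong (2 ^ n +_) (+-identityʳ (2 ^ n))

%≡%⇒+*≡+* : ∀ a b n .{{_ : NonZero n}} → a % n ≡ b % n → a + b / n * n ≡ b + a / n * n
%≡%⇒+*≡+* a b n a%n≡b%n = begin
  a + b / n * n                  ≡⟨ cong (_+ b / n * n) (m≡m%n+[m/n]*n a n) ⟩
  a % n + a / n * n + b / n * n  ≡⟨ cong (λ r → r + a / n * n + b / n * n) a%n≡b%n ⟩
  b % n + a / n * n + b / n * n  ≡⟨ xy∙z≈xz∙y (b % n) _ _ ⟩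
  b % n + b / n * n + a / n * n  ≡⟨ cong (_+ a / n * n) (m≡m%n+[m/n]*n b n) ⟨
  b + a / n * n                  ∎
  where open ≡-Reasoning

+-∣-≡⇒%≡ : ∀ {d} .{{_ : NonZero d}} {l h c r} →
           d ∣ h → d ∣ r → c <ℕ d → l + h ≡ c + r → l % d ≡ c
+-∣-≡⇒%≡ {d} {l = l} {h} {c} {r} d∣h d∣r c<d l+h≡c+r = begin
  l % d        ≡⟨ %-remove-+ʳ l d∣h ⟨
  (l + h) % d  ≡⟨ cong (_% d) l+h≡c+r ⟩
  (c + r) % d  ≡⟨ %-remove-+ʳ c d∣r ⟩
  c % d        ≡⟨ m<n⇒m%n≡m c<d ⟩
  c            ∎
  where open ≡-Reasoning

∣-sumAll : ∀ {d} n (g : Fin n → ℕ) → (∀ i → d ∣ g i) → d ∣ sumAll n g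
∣-sumAll zero    g d∣g = _ ∣0
∣-sumAll (suc n) g d∣g = ∣m∣n⇒∣m+n (d∣g fz) (∣-sumAll n (g ∘ fs) (d∣g ∘ fs))

StrictlyIncreasing : ∀ {k} → (Fin k → ℕ) → Set
StrictlyIncreasing w = ∀ a b → a < b → w a <ℕ w b

≤-fromℕ : ∀ {k} (w : Fin (suc k) → ℕ) → StrictlyIncreasing w → ∀ i → w i ≤ w (fromℕ k)
≤-fromℕ {k} w w↑ i with i ≟ᶠ fromℕ k
... | yes refl = ≤-refl
... | no  i≢k  = <⇒≤ (w↑ i (fromℕ k) (≤∧≢⇒<ᶠ (≤fromℕ i) i≢k))

x∈p─q⇒x∉q : ∀ {n} (p q : Subset n) {i} → i ∈ p ─ q → i ∉ q
x∈p─q⇒x∉q (_ ∷ p) (true  ∷ q) (there i∈p─q) (there i∈q) = x∈p─q⇒x∉q p q i∈p─q i∈q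
x∈p─q⇒x∉q (_ ∷ p) (false ∷ q) (there i∈p─q) (there i∈q) = x∈p─q⇒x∉q p q i∈p─q i∈q

⊆─⇒disjoint : ∀ {n} (p q : Subset n) {r} → r ⊆ p ─ q → Empty (q ∩ r)
⊆─⇒disjoint p q {r} r⊆p─q (i , i∈q∩r) =
  let i∈q , i∈r = x∈p∩q⁻ q r i∈q∩r in x∈p─q⇒x∉q p q (r⊆p─q i∈r) i∈q

∪-⊆─ : ∀ {n} (p q : Subset n) {r} → q ⊆ p → r ⊆ p ─ q → q ∪ r ⊆ p
∪-⊆─ p q {r} q⊆p r⊆p─q i∈q∪r with x∈p∪q⁻ q r i∈q∪r
... | inj₁ i∈q = q⊆p i∈q
... | inj₂ i∈r = p─q⊆p p q (r⊆p─q i∈r)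

PairwiseDisjoint : ∀ {k n} → (Fin k → Subset n) → Set
PairwiseDisjoint J = ∀ a b → a ≢ b → Empty (J a ∩ J b)

◃-pairwiseDisjoint : ∀ {k n} {J₀ : Subset n} {J : Fin k → Subset n} →
                     (∀ i → Empty (J₀ ∩ J i)) → PairwiseDisjoint J → PairwiseDisjoint (J₀ ◃ J)
◃-pairwiseDisjoint J₀∩J=∅ J-disjoint fz     fz     0≢0 = contradiction refl 0≢0
◃-pairwiseDisjoint J₀∩J=∅ J-disjoint fz     (fs i) _   = J₀∩J=∅ i
◃-pairwiseDisjoint {J₀ = J₀} {J} J₀∩J=∅ J-disjoint (fs i) fz _ =
  subst Empty (∩-comm J₀ (J i)) (J₀∩J=∅ i)
◃-pairwiseDisjoint J₀∩J=∅ J-disjoint (fs a) (fs b) a≢b = J-disjoint a b (a≢b ∘ cong fs)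

sumOver-⊥ : ∀ {n} (f : Fin n → ℕ) → sumOver ⊥ f ≡ 0
sumOver-⊥ {zero}  f = refl
sumOver-⊥ {suc n} f = sumOver-⊥ (f ∘ fs)

sumOver-⁅⁆ : ∀ {n} (i : Fin n) (f : Fin n → ℕ) → sumOver ⁅ i ⁆ f ≡ f i
sumOver-⁅⁆ fz     f = trans (cong (f fz +_) (sumOver-⊥ (f ∘ fs))) (+-identityʳ (f fz))
sumOver-⁅⁆ (fs i) f = sumOver-⁅⁆ i (f ∘ fs)

sumOver-⊤ : ∀ n (f : Fin n → ℕ) → sumOver ⊤ f ≡ sumAll n f
sumOver-⊤ zero    f = refl
sumOver-⊤ (suc n) f = cong (f fz +_) (sumOver-⊤ n (f ∘ fs))

Empty-∩-tail : ∀ {n} s u {p q : Subset n} → Empty ((s ∷ p) ∩ (u ∷ q)) → Empty (p ∩ q)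
Empty-∩-tail _ _ sp∩uq=∅ (i , i∈p∩q) = sp∩uq=∅ (fs i , there i∈p∩q)

sumOver-∪ : ∀ {n} (p q : Subset n) (f : Fin n → ℕ) → Empty (p ∩ q) →
            sumOver (p ∪ q) f ≡ sumOver p f + sumOver q f
sumOver-∪ []          []          f _ = refl
sumOver-∪ (true ∷ p)  (true ∷ q)  f ∅ = ⊥-elim (∅ (fz , here))
sumOver-∪ (true ∷ p)  (false ∷ q) f ∅ =
  trans (cong (f fz +_) (sumOver-∪ p q (f ∘ fs) (Empty-∩-tail true false ∅))) (sym (+-assoc (f fz) _ _))
sumOver-∪ (false ∷ p) (true ∷ q)  f ∅ =
  trans (cong (f fz +_) (sumOver-∪ p q (f ∘ fs) (Empty-∩-tail false true ∅)))
        (x∙yz≈y∙xz (f fz) (sumOver p (f ∘ fs)) (sumOver q (f ∘ fs)))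
sumOver-∪ (false ∷ p) (false ∷ q) f ∅ = sumOver-∪ p q (f ∘ fs) (Empty-∩-tail false false ∅)

sumOver-─ : ∀ {n} (p q : Subset n) (f : Fin n → ℕ) → q ⊆ p →
            sumOver p f ≡ sumOver q f + sumOver (p ─ q) f
sumOver-─ []          []          f _   = refl
sumOver-─ (true ∷ p)  (true ∷ q)  f q⊆p =
  trans (cong (f fz +_) (sumOver-─ p q (f ∘ fs) (drop-∷-⊆ q⊆p))) (sym (+-assoc (f fz) _ _))
sumOver-─ (true ∷ p)  (false ∷ q) f q⊆p =
  trans (cong (f fz +_) (sumOver-─ p q (f ∘ fs) (drop-∷-⊆ q⊆p)))
        (x∙yz≈y∙xz (f fz) (sumOver q (f ∘ fs)) (sumOver (p ─ q) (f ∘ fs)))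
sumOver-─ (false ∷ p) (true ∷ q)  f q⊆p with q⊆p here
... | ()
sumOver-─ (false ∷ p) (false ∷ q) f q⊆p = sumOver-─ p q (f ∘ fs) (drop-∷-⊆ q⊆p)

sumOver-─-≥ : ∀ {n} (p q : Subset n) (f : Fin n → ℕ) {m} → q ⊆ p →
              sumOver q f + m ≤ sumOver p f → m ≤ sumOver (p ─ q) f
sumOver-─-≥ p q f {m} q⊆p Σq+m≤Σp =
  +-cancelˡ-≤ (sumOver q f) _ _ (subst (sumOver q f + m ≤_) (sumOver-─ p q f q⊆p) Σq+m≤Σp)

sumOver-─-cancel : ∀ {n} (p q : Subset n) (f : Fin n → ℕ) {m o} → q ⊆ p →
                   sumOver p f + m ≡ sumOver q f + o → sumOver (p ─ q) f + m ≡ o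
sumOver-─-cancel p q f {m} {o} q⊆p Σp+m≡Σq+o = +-cancelˡ-≡ (sumOver q f) _ _ (begin
  sumOver q f + (sumOver (p ─ q) f + m) ≡⟨ +-assoc (sumOver q f) _ m ⟨
  sumOver q f + sumOver (p ─ q) f + m   ≡⟨ cong (_+ m) (sumOver-─ p q f q⊆p) ⟨
  sumOver p f + m                       ≡⟨ Σp+m≡Σq+o ⟩
  sumOver q f + o                       ∎)
  where open ≡-Reasoning

∣-sumOver : ∀ {n d} (p : Subset n) (f : Fin n → ℕ) → (∀ {i} → i ∈ p → d ∣ f i) → d ∣ sumOver p f
∣-sumOver []          f d∣f = _ ∣0
∣-sumOver (true ∷ p)  f d∣f = ∣m∣n⇒∣m+n (d∣f here) (∣-sumOver p (f ∘ fs) (d∣f ∘ there))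
∣-sumOver (false ∷ p) f d∣f = ∣-sumOver p (f ∘ fs) (d∣f ∘ there)

sumOver>0⇒Nonempty : ∀ {n} (p : Subset n) (f : Fin n → ℕ) → 0 <ℕ sumOver p f → Nonempty p
sumOver>0⇒Nonempty (true ∷ p)  f _   = fz , here
sumOver>0⇒Nonempty (false ∷ p) f Σ>0 =
  let i , i∈p = sumOver>0⇒Nonempty p (f ∘ fs) Σ>0 in fs i , there i∈p

atMost : ∀ {n} → ℕ → (Fin n → ℕ) → Subset n
atMost {zero}  a x = []
atMost {suc n} a x = (x fz ≤ᵇ a) ∷ atMost a (x ∘ fs)

∈atMost⁻ : ∀ {n} a (x : Fin n → ℕ) {i} → i ∈ atMost a x → x i ≤ a
∈atMost⁻ a x {fz}   i∈         = ≤ᵇ⇒≤ (x fz) a (subst T (sym ([]=⇒lookup i∈)) _)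
∈atMost⁻ a x {fs i} (there i∈) = ∈atMost⁻ a (x ∘ fs) i∈

∈atMost⁺ : ∀ {n} a (x : Fin n → ℕ) {i} → x i ≤ a → i ∈ atMost a x
∈atMost⁺ a x {fz} x₀≤a with x fz ≤ᵇ a | ≤⇒≤ᵇ x₀≤a
... | true | _ = here
∈atMost⁺ a x {fs i} xᵢ≤a = there (∈atMost⁺ a (x ∘ fs) xᵢ≤a)

module _ {t} (x : Fin t → ℕ) where

  private
    2^x : Fin t → ℕ
    2^x j = 2 ^ x j

  SubsetSum : ℕ → Subset t → Set
  SubsetSum n A = ∃[ J ] J ⊆ A × sumOver J 2^x ≡ n

  singleton-subsetSum : ∀ {a A} j → j ∈ A → x j ≡ a → SubsetSum (2 ^ a) A
  singleton-subsetSum {A = A} j j∈A refl =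
    ⁅ j ⁆ , (λ i∈⁅j⁆ → subst (_∈ A) (sym (x∈⁅y⁆⇒x≡y j i∈⁅j⁆)) j∈A) , sumOver-⁅⁆ j 2^x

  2^-subsetSum : ∀ a (A : Subset t) → (∀ {j} → j ∈ A → x j ≤ a) → 2 ^ a ≤ sumOver A 2^x →
                 SubsetSum (2 ^ a) A
  2^-subsetSum zero A x≤0 1≤ΣA =
    let j , j∈A = sumOver>0⇒Nonempty A 2^x 1≤ΣA in singleton-subsetSum j j∈A (n≤0⇒n≡0 (x≤0 j∈A))
  2^-subsetSum (suc a) A x≤1+a 2^[1+a]≤ΣA with any? (λ j → j ∈? A ×-dec x j ≟ suc a)
  ... | yes (j , j∈A , xⱼ≡1+a) = singleton-subsetSum j j∈A xⱼ≡1+a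
  ... | no  ∄j =
    let J₁ , J₁⊆A , ΣJ₁≡2^a = 2^-subsetSum a A x≤a (≤-trans (^-monoʳ-≤ 2 (n≤1+n a)) 2^[1+a]≤ΣA)
        J₂ , J₂⊆A─J₁ , ΣJ₂≡2^a = 2^-subsetSum a (A ─ J₁) (x≤a ∘ p─q⊆p A J₁) (remainder J₁⊆A ΣJ₁≡2^a)
    in J₁ ∪ J₂ , ∪-⊆─ A J₁ J₁⊆A J₂⊆A─J₁ , (begin
      sumOver (J₁ ∪ J₂) 2^x           ≡⟨ sumOver-∪ J₁ J₂ 2^x (⊆─⇒disjoint A J₁ J₂⊆A─J₁) ⟩
      sumOver J₁ 2^x + sumOver J₂ 2^x ≡⟨ cong₂ _+_ ΣJ₁≡2^a ΣJ₂≡2^a ⟩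
      2 ^ a + 2 ^ a                   ≡⟨ 2^[1+n]≡2^n+2^n a ⟨
      2 ^ suc a                       ∎)
    where
      open ≡-Reasoning

      x≤a : ∀ {j} → j ∈ A → x j ≤ a
      x≤a j∈A = s≤s⁻¹ (≤∧≢⇒< (x≤1+a j∈A) (λ xⱼ≡1+a → ∄j (_ , j∈A , xⱼ≡1+a)))

      remainder : ∀ {J} → J ⊆ A → sumOver J 2^x ≡ 2 ^ a → 2 ^ a ≤ sumOver (A ─ J) 2^x
      remainder {J} J⊆A ΣJ≡2^a = sumOver-─-≥ A J 2^x J⊆A
        (subst (λ s → s + 2 ^ a ≤ sumOver A 2^x) (sym ΣJ≡2^a)
               (subst (_≤ sumOver A 2^x) (2^[1+n]≡2^n+2^n a) 2^[1+a]≤ΣA))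

  2^≤sumOver-atMost : ∀ a A {m o} → 2 ^ suc a ∣ m → 2 ^ suc a ∣ o →
                      sumOver A 2^x + m ≡ 2 ^ a + o → 2 ^ a ≤ sumOver (A ∩ atMost a x) 2^x
  2^≤sumOver-atMost a A {m} {o} d∣m d∣o ΣA+m≡2^a+o =
    subst (_≤ sumOver low 2^x) Σlow%d≡2^a (m%n≤m (sumOver low 2^x) d)
    where
      low = A ∩ atMost a x
      d = 2 ^ suc a
      instance _ = m^n≢0 2 (suc a)

      d∣high : ∀ {j} → j ∈ A ─ low → d ∣ 2 ^ x j
      d∣high j∈ = ^-monoʳ-∣ 2 (≰⇒> λ xⱼ≤a →
        x∈p─q⇒x∉q A low j∈ (x∈p∩q⁺ (p─q⊆p A low j∈ , ∈atMost⁺ a x xⱼ≤a)))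

      Σlow%d≡2^a : sumOver low 2^x % d ≡ 2 ^ a
      Σlow%d≡2^a = +-∣-≡⇒%≡ (∣m∣n⇒∣m+n (∣-sumOver (A ─ low) 2^x d∣high) d∣m) d∣o
        (^-monoʳ-< 2 (s≤s (s≤s z≤n)) (n<1+n a)) (begin
          sumOver low 2^x + (sumOver (A ─ low) 2^x + m) ≡⟨ +-assoc (sumOver low 2^x) _ m ⟨
          sumOver low 2^x + sumOver (A ─ low) 2^x + m   ≡⟨ cong (_+ m) (sumOver-─ A low 2^x (p∩q⊆p A _)) ⟨
          sumOver A 2^x + m                            ≡⟨ ΣA+m≡2^a+o ⟩
          2 ^ a + o                                    ∎)
        where open ≡-Reasoning

  Decomposition : ∀ {k} → (Fin k → ℕ) → Subset t → Set
  Decomposition {k} w A = Σ (Fin k → Subset t) λ J →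
    (∀ i → J i ⊆ A) × PairwiseDisjoint J × (∀ i → 2 ^ w i ≡ sumOver (J i) 2^x)

  -- The congruence modulo 2^M is carried with explicit multiples of 2^M so that terms can be cancelled.
  decompose : ∀ {k} (w : Fin k → ℕ) M → StrictlyIncreasing w → (∀ i → w i <ℕ M) →
              ∀ A p q → sumOver A 2^x + p * 2 ^ M ≡ sumAll k (λ i → 2 ^ w i) + q * 2 ^ M →
              Decomposition w A
  decompose {zero} w M w↑ w<M A p q _ = (λ ()) , (λ ()) , (λ ()) , (λ ())
  decompose {suc k} w M w↑ w<M A p q ≡mod =
    let J₀ , J₀⊆low , ΣJ₀≡2^w₀ = 2^-subsetSum w₀ low (∈atMost⁻ w₀ x ∘ p∩q⊆q A (atMost w₀ x))
                                   (2^≤sumOver-atMost w₀ A 2^[1+w₀]∣p*2^M 2^[1+w₀]∣tail+q*2^M shifted)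
        J₀⊆A : J₀ ⊆ A
        J₀⊆A = p∩q⊆p A (atMost w₀ x) ∘ J₀⊆low
        J , J⊆A─J₀ , J-disjoint , J-sums =
          decompose (w ∘ fs) M (λ a b → w↑ (fs a) (fs b) ∘ s≤s) (w<M ∘ fs) (A ─ J₀) p q
            (sumOver-─-cancel A J₀ 2^x J₀⊆A (trans shifted (cong (_+ _) (sym ΣJ₀≡2^w₀))))
    in J₀ ◃ J
     , (λ { fz → J₀⊆A ; (fs i) → p─q⊆p A J₀ ∘ J⊆A─J₀ i })
     , ◃-pairwiseDisjoint (λ i → ⊆─⇒disjoint A J₀ (J⊆A─J₀ i)) J-disjoint
     , (λ { fz → sym ΣJ₀≡2^w₀ ; (fs i) → J-sums i })
    where
      w₀ = w fz
      tail = sumAll k (λ i → 2 ^ w (fs i))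
      low = A ∩ atMost w₀ x

      shifted : sumOver A 2^x + p * 2 ^ M ≡ 2 ^ w₀ + (tail + q * 2 ^ M)
      shifted = trans ≡mod (+-assoc (2 ^ w₀) tail (q * 2 ^ M))

      2^[1+w₀]∣2^M : 2 ^ suc w₀ ∣ 2 ^ M
      2^[1+w₀]∣2^M = ^-monoʳ-∣ 2 (w<M fz)

      2^[1+w₀]∣p*2^M : 2 ^ suc w₀ ∣ p * 2 ^ M
      2^[1+w₀]∣p*2^M = ∣-trans 2^[1+w₀]∣2^M (n∣m*n p)

      2^[1+w₀]∣tail+q*2^M : 2 ^ suc w₀ ∣ tail + q * 2 ^ M
      2^[1+w₀]∣tail+q*2^M = ∣m∣n⇒∣m+n (∣-sumAll k _ (λ i → ^-monoʳ-∣ 2 (w↑ fz (fs i) z<s)))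
                                    (∣-trans 2^[1+w₀]∣2^M (n∣m*n q))

lemma2p2 : (k t : ℕ) (w : Fin (suc k) → ℕ) (x : Fin t → ℕ) →
           (∀ a b → a < b → w a <ℕ w b) →
           (∀ j → x j <ℕ w (fromℕ k) + 1) →
           sumAll (suc k) (λ i → 2 ^ w i)
             ≡ sumAll t (λ j → 2 ^ x j) [mod2^ w (fromℕ k) + 1 ] →
           Σ (Fin (suc k) → Subset t) λ J →
             (∀ i → Nonempty (J i))
             × (∀ a b → a ≢ b → Empty (J a ∩ J b))
             × (∀ i → 2 ^ w i ≡ sumOver (J i) (λ j → 2 ^ x j))
lemma2p2 k t w x w↑ _ w≡x =
  let J , _ , disjoint , sums = decompose x w M w↑ w<M ⊤ (N / D) (S / D) balanced
      nonempty : ∀ i → Nonempty (J i)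
      nonempty i = sumOver>0⇒Nonempty (J i) (λ j → 2 ^ x j) (subst (0 <ℕ_) (sums i) (m^n>0 2 (w i)))
  in J , nonempty , disjoint , sums
  where
    M = w (fromℕ k) + 1
    D = 2 ^ M
    N = sumAll (suc k) (λ i → 2 ^ w i)
    S = sumAll t (λ j → 2 ^ x j)
    instance _ = m^n≢0 2 M

    w<M : ∀ i → w i <ℕ M
    w<M i = ≤-<-trans (≤-fromℕ w w↑ i) (m<m+n (w (fromℕ k)) z<s)

    balanced : sumOver ⊤ (λ j → 2 ^ x j) + N / D * D ≡ N + S / D * D
    balanced = begin
      sumOver ⊤ (λ j → 2 ^ x j) + N / D * D ≡⟨ cong (_+ N / D * D) (sumOver-⊤ t (λ j → 2 ^ x j)) ⟩
      S + N / D * D                         ≡⟨ %≡%⇒+*≡+* S N D (sym w≡x) ⟩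
      N + S / D * D                         ∎
      where open ≡-Reasoning
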